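{- Let $r$ be a prime and $M_r=2^r-1$. Then $M_r$ is prime if and only if the arithmetic progression $(1+rx)_{x\ge0}$ contains exactly one prime $p$ with $h_2(p)=r$.
   Context: For an odd integer $m>1$, $h_2(m)$ denotes the multiplicative order of 2 modulo $m$. -}

module Defs where

open import Data.Nat using (ℕ; _+_; _*_; _∸_; _^_; _≤_; _<_)
open import Data.Nat.Divisibility using (_∣_)
open import Data.Product using (_×_)

-- h₂ m ≡ k, as a relation: k is the multiplicative order of 2 modulo m,
-- i.e. the least positive k with m ∣ 2^k − 1.
IsOrder2 : ℕ → ℕ → Set
IsOrder2 m k =
  (0 < k) × (m ∣ (2 ^ k ∸ 1)) × (∀ j → 0 < j → m ∣ (2 ^ j ∸ 1) → k ≤ j)

Mersenne : ℕ → ℕ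
Mersenne r = 2 ^ r ∸ 1

{-# OPTIONS --safe #-}
module Submission where

-- Every prime factor q of M_r has h₂(q) = r, because r is prime and q ∤ M_1 = 1;
-- by Fermat's little theorem r ∣ q − 1, so q lies in the progression 1 + r x.
-- Hence M_r is prime exactly when it has a single prime factor p, and it remains
-- to exclude M_r = p^k with k > 1. For even k, M_r ≡ 3 (mod 4) is not a square.
-- For odd k, p + 1 ∣ p^k + 1 = 2^r, so p = M_s; as h₂(M_s) = s, s = r and k = 1.

open import Defs
open import Algebra.Properties.CommutativeSemigroup using (interchange)
open import Data.List using ([]; _∷_; length)
open import Data.List.Relation.Unary.All using (All; []; _∷_)
open import Data.Nat
open import Data.Nat.Combinatorics using (_C_; nCn≡1; nCk≡n!/k![n-k]!; k![n∸k]!∣n!; nCk+nC[k+1]≡[n+1]C[k+1])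
open import Data.Nat.Divisibility
open import Data.Nat.DivMod using (_%_; m/n*n≡m; m%n<n; %-distribˡ-*; [m+kn]%n≡m%n)
open import Data.Nat.GCD using (gcd; gcd-GCD; gcd[m,n]∣m; gcd[m,n]∣n; module Bézout)
open import Data.Nat.ListAction using (product)
open import Data.Nat.Primality using (Prime; euclidsLemma; prime⇒irreducible; prime⇒nonTrivial; prime[2])
open import Data.Nat.Primality.Factorisation using (PrimeFactorisation; factorise)
open import Data.Nat.Properties
open import Data.Nat.Tactic.RingSolver using (solve-∀)
open import Data.Product using (Σ; ∃; _×_; _,_)
open import Data.Sum using (_⊎_; inj₁; inj₂)
open import Function.Bundles using (_⇔_; mk⇔)
open import Relation.Binary.PropositionalEquality
open import Relation.Nullary using (contradiction)

prime⇒>1 : ∀ {p} → Prime p → 1 < p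
prime⇒>1 {p} pp = nonTrivial⇒n>1 p {{prime⇒nonTrivial pp}}

prime≢1 : ∀ {p} → Prime p → p ≢ 1
prime≢1 pp refl = <-irrefl refl (prime⇒>1 pp)

∣prime⇒≡ : ∀ {p q} → Prime p → q ≢ 1 → q ∣ p → q ≡ p
∣prime⇒≡ pp q≢1 q∣p with prime⇒irreducible pp q∣p
... | inj₁ q≡1 = contradiction q≡1 q≢1
... | inj₂ q≡p = q≡p

prime∣2^n⇒≡2 : ∀ {q} n → Prime q → q ∣ 2 ^ n → q ≡ 2
prime∣2^n⇒≡2 zero    pq q∣1 = contradiction (∣1⇒≡1 q∣1) (prime≢1 pq)
prime∣2^n⇒≡2 (suc n) pq q∣2*2^n with euclidsLemma 2 (2 ^ n) pq q∣2*2^n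
... | inj₁ q∣2   = ∣prime⇒≡ prime[2] (prime≢1 pq) q∣2
... | inj₂ q∣2^n = prime∣2^n⇒≡2 n pq q∣2^n

product≡^length : ∀ {p} fs → All Prime fs →
  (∀ q → Prime q → q ∣ product fs → q ≡ p) → product fs ≡ p ^ length fs
product≡^length []       []         _    = refl
product≡^length (f ∷ fs) (pf ∷ pfs) only =
  cong₂ _*_ (only f pf (m∣m*n (product fs)))
            (product≡^length fs pfs (λ q pq q∣ → only q pq (∣n⇒∣m*n f q∣)))

onlyPrimeDivisor⇒power : ∀ {n p} .{{_ : NonZero n}} →
  (∀ q → Prime q → q ∣ n → q ≡ p) → ∃ λ k → n ≡ p ^ k
onlyPrimeDivisor⇒power {n} only =
  length factors , trans isFactorisation
    (product≡^length factors factorsPrime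
      (λ q pq q∣ → only q pq (subst (q ∣_) (sym isFactorisation) q∣)))
  where open PrimeFactorisation (factorise n)

∣2^n⇒≡2^ : ∀ {d} n → d ∣ 2 ^ n → ∃ λ s → d ≡ 2 ^ s
∣2^n⇒≡2^ {d} n d∣2^n = onlyPrimeDivisor⇒power {{d≢0}} (λ q pq q∣d → prime∣2^n⇒≡2 n pq (∣-trans q∣d d∣2^n))
  where
  d≢0 : NonZero d
  d≢0 = ≢-nonZero λ { refl → ≢-nonZero⁻¹ (2 ^ n) {{m^n≢0 2 n}} (0∣⇒≡0 d∣2^n) }

2^n≡1+Mersenne : ∀ n → 2 ^ n ≡ 1 + Mersenne n
2^n≡1+Mersenne n = sym (m+[n∸m]≡n (m^n>0 2 n))

Mersenne-+ : ∀ m n → Mersenne (m + n) ≡ Mersenne m + 2 ^ m * Mersenne n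
Mersenne-+ m n = +-cancelˡ-≡ 1 _ _ (begin
  1 + Mersenne (m + n)                   ≡⟨ 2^n≡1+Mersenne (m + n) ⟨
  2 ^ (m + n)                            ≡⟨ ^-distribˡ-+-* 2 m n ⟩
  2 ^ m * 2 ^ n                          ≡⟨ cong (2 ^ m *_) (2^n≡1+Mersenne n) ⟩
  2 ^ m * (1 + Mersenne n)               ≡⟨ *-distribˡ-+ (2 ^ m) 1 (Mersenne n) ⟩
  2 ^ m * 1 + 2 ^ m * Mersenne n         ≡⟨ cong (_+ 2 ^ m * Mersenne n) (*-identityʳ (2 ^ m)) ⟩
  2 ^ m + 2 ^ m * Mersenne n             ≡⟨ cong (_+ 2 ^ m * Mersenne n) (2^n≡1+Mersenne m) ⟩
  1 + Mersenne m + 2 ^ m * Mersenne n    ≡⟨ +-assoc 1 (Mersenne m) _ ⟩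
  1 + (Mersenne m + 2 ^ m * Mersenne n)  ∎)
  where open ≡-Reasoning

Mersenne-suc : ∀ n → Mersenne (suc n) ≡ 1 + 2 * Mersenne n
Mersenne-suc = Mersenne-+ 1

Mersenne≢0 : ∀ {n} → 0 < n → NonZero (Mersenne n)
Mersenne≢0 {suc n} _ = ≢-nonZero λ eq → 0≢1+n (trans (sym eq) (Mersenne-suc n))

2∤Mersenne : ∀ {n} → 0 < n → 2 ∤ Mersenne n
2∤Mersenne {suc n} _ (divides c eq) =
  even≢odd c (Mersenne n) (trans (*-comm 2 c) (trans (sym eq) (Mersenne-suc n)))

Mersenne-monoʳ-< : ∀ {m n} → m < n → Mersenne m < Mersenne n
Mersenne-monoʳ-< {m} {n} m<n = +-cancelˡ-< 1 _ _
  (subst₂ _<_ (2^n≡1+Mersenne m) (2^n≡1+Mersenne n) (^-monoʳ-< 2 (s≤s (s≤s z≤n)) m<n))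

Mersenne-cancel-≤ : ∀ {m n} → Mersenne m ≤ Mersenne n → m ≤ n
Mersenne-cancel-≤ Mm≤Mn = ≮⇒≥ λ n<m → <⇒≱ (Mersenne-monoʳ-< n<m) Mm≤Mn

∣Mersenne[m+n]∣Mersenne[n]⇒∣Mersenne[m] : ∀ {q} m n →
  q ∣ Mersenne (m + n) → q ∣ Mersenne n → q ∣ Mersenne m
∣Mersenne[m+n]∣Mersenne[n]⇒∣Mersenne[m] {q} m n q∣Mm+n q∣Mn =
  ∣m+n∣m⇒∣n (subst (q ∣_) (trans (Mersenne-+ m n) (+-comm (Mersenne m) _)) q∣Mm+n) (∣n⇒∣m*n (2 ^ m) q∣Mn)

∣Mersenne⇒∣Mersenne[k*n] : ∀ {q} k n → q ∣ Mersenne n → q ∣ Mersenne (k * n)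
∣Mersenne⇒∣Mersenne[k*n] {q} zero n _ = q ∣0
∣Mersenne⇒∣Mersenne[k*n] {q} (suc k) n q∣Mn =
  subst (q ∣_) (sym (Mersenne-+ n (k * n)))
    (∣m∣n⇒∣m+n q∣Mn (∣n⇒∣m*n (2 ^ n) (∣Mersenne⇒∣Mersenne[k*n] k n q∣Mn)))

-- Bézout: gcd m n + (multiple of one of m, n) = (multiple of the other).
∣Mersenne-gcd : ∀ {q} m n → q ∣ Mersenne m → q ∣ Mersenne n → q ∣ Mersenne (gcd m n)
∣Mersenne-gcd {q} m n q∣Mm q∣Mn with Bézout.identity (gcd-GCD m n)
... | Bézout.+- x y eq = ∣Mersenne[m+n]∣Mersenne[n]⇒∣Mersenne[m] (gcd m n) (y * n)
        (subst (λ e → q ∣ Mersenne e) (sym eq) (∣Mersenne⇒∣Mersenne[k*n] x m q∣Mm))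
        (∣Mersenne⇒∣Mersenne[k*n] y n q∣Mn)
... | Bézout.-+ x y eq = ∣Mersenne[m+n]∣Mersenne[n]⇒∣Mersenne[m] (gcd m n) (x * m)
        (subst (λ e → q ∣ Mersenne e) (sym eq) (∣Mersenne⇒∣Mersenne[k*n] y n q∣Mn))
        (∣Mersenne⇒∣Mersenne[k*n] x m q∣Mm)

∣Mersenne[prime]⇒∣ : ∀ {q r j} → Prime r → q ≢ 1 →
  q ∣ Mersenne r → q ∣ Mersenne j → r ∣ j
∣Mersenne[prime]⇒∣ {q} {r} {j} pr q≢1 q∣Mr q∣Mj with prime⇒irreducible pr (gcd[m,n]∣m r j)
... | inj₁ gcd≡1 = contradiction (∣1⇒≡1 (subst (λ e → q ∣ Mersenne e) gcd≡1 (∣Mersenne-gcd r j q∣Mr q∣Mj))) q≢1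
... | inj₂ gcd≡r = subst (_∣ j) gcd≡r (gcd[m,n]∣n r j)

∣Mersenne[prime]⇒IsOrder2 : ∀ {q r} → Prime r → q ≢ 1 → q ∣ Mersenne r → IsOrder2 q r
∣Mersenne[prime]⇒IsOrder2 pr q≢1 q∣Mr =
  <⇒≤ (prime⇒>1 pr) , q∣Mr ,
  λ { (suc j) _ q∣Mj → ∣⇒≤ (∣Mersenne[prime]⇒∣ pr q≢1 q∣Mr q∣Mj) }

IsOrder2[Mersenne] : ∀ {r s} → 0 < s → IsOrder2 (Mersenne s) r → s ≡ r
IsOrder2[Mersenne] {r} {s} 0<s (0<r , Ms∣Mr , minimal) = ≤-antisym
  (Mersenne-cancel-≤ (∣⇒≤ {{Mersenne≢0 0<r}} Ms∣Mr))
  (minimal s 0<s ∣-refl)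

prime∤! : ∀ {p} m → Prime p → m < p → p ∤ m !
prime∤! zero    pp _   p∣1 = prime≢1 pp (∣1⇒≡1 p∣1)
prime∤! (suc m) pp m<p p∣m! with euclidsLemma (suc m) (m !) pp p∣m!
... | inj₁ p∣m = <⇒≱ m<p (∣⇒≤ p∣m)
... | inj₂ p∣m! = prime∤! m pp (<-trans (n<1+n m) m<p) p∣m!

prime∣C : ∀ {p k} → Prime p → 0 < k → k < p → p ∣ p C k
prime∣C {p@(suc n)} {k} pp 0<k k<p with euclidsLemma (p C k) (k ! * (p ∸ k) !) pp p∣C*k!*[p∸k]!
  where
  instance _ = k !* (p ∸ k) !≢0
  p∣C*k!*[p∸k]! : p ∣ (p C k) * (k ! * (p ∸ k) !)
  p∣C*k!*[p∸k]! = subst (p ∣_)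
    (sym (trans (cong (_* (k ! * (p ∸ k) !)) (nCk≡n!/k![n-k]! (<⇒≤ k<p))) (m/n*n≡m (k![n∸k]!∣n! (<⇒≤ k<p)))))
    (m∣m*n (n !))
... | inj₁ p∣C = p∣C
... | inj₂ p∣k!*[p∸k]! with euclidsLemma (k !) ((p ∸ k) !) pp p∣k!*[p∸k]!
...   | inj₁ p∣k!     = contradiction p∣k! (prime∤! k pp k<p)
...   | inj₂ p∣[p∸k]! = contradiction p∣[p∸k]! (prime∤! (p ∸ k) pp (∸-monoʳ-< 0<k (<⇒≤ k<p)))

binomialPrefix : ℕ → ℕ → ℕ
binomialPrefix n zero    = 0
binomialPrefix n (suc m) = binomialPrefix n m + n C m

binomialPrefix-pascal : ∀ n m →
  binomialPrefix (suc n) (suc m) ≡ binomialPrefix n m + binomialPrefix n (suc m)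
binomialPrefix-pascal n zero    = refl
binomialPrefix-pascal n (suc m) = begin
  binomialPrefix (suc n) (suc m) + suc n C suc m
    ≡⟨ cong₂ _+_ (binomialPrefix-pascal n m) (sym (nCk+nC[k+1]≡[n+1]C[k+1] n m)) ⟩
  (binomialPrefix n m + binomialPrefix n (suc m)) + (n C m + n C suc m)
    ≡⟨ interchange +-commutativeSemigroup (binomialPrefix n m) _ _ _ ⟩
  binomialPrefix n (suc m) + binomialPrefix n (suc (suc m)) ∎
  where open ≡-Reasoning

binomialPrefix≡2^n : ∀ n m → n < m → binomialPrefix n m ≡ 2 ^ n
binomialPrefix≡2^n zero    (suc zero)    _         = refl
binomialPrefix≡2^n zero    (suc (suc m)) _         =
  trans (+-identityʳ _) (binomialPrefix≡2^n zero (suc m) z<s)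
binomialPrefix≡2^n (suc n) (suc m)       (s<s n<m) = begin
  binomialPrefix (suc n) (suc m)                   ≡⟨ binomialPrefix-pascal n m ⟩
  binomialPrefix n m + binomialPrefix n (suc m)    ≡⟨ cong₂ _+_ (binomialPrefix≡2^n n m n<m) (binomialPrefix≡2^n n (suc m) (m<n⇒m<1+n n<m)) ⟩
  2 ^ n + 2 ^ n                                    ≡⟨ cong (2 ^ n +_) (+-identityʳ (2 ^ n)) ⟨
  2 ^ suc n                                        ∎
  where open ≡-Reasoning

binomialPrefix[prime]≡1+c*p : ∀ {p} m → Prime p → m < p → ∃ λ c → binomialPrefix p (suc m) ≡ 1 + c * p
binomialPrefix[prime]≡1+c*p zero    pp _   = 0 , refl
binomialPrefix[prime]≡1+c*p {p} (suc m) pp m<p with binomialPrefix[prime]≡1+c*p m pp (<-trans (n<1+n m) m<p) | prime∣C pp z<s m<p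
... | c , eq | divides d eq′ = c + d , (begin
  binomialPrefix p (suc m) + p C suc m  ≡⟨ cong₂ _+_ eq eq′ ⟩
  1 + c * p + d * p                     ≡⟨ +-assoc 1 (c * p) (d * p) ⟩
  1 + (c * p + d * p)                   ≡⟨ cong (1 +_) (*-distribʳ-+ p c d) ⟨
  1 + (c + d) * p                       ∎)
  where open ≡-Reasoning

fermat₂ : ∀ {p} → Prime p → ∃ λ c → 2 ^ p ≡ 2 + c * p
fermat₂ {p@(suc n)} pp with binomialPrefix[prime]≡1+c*p n pp ≤-refl
... | c , eq = c , (begin
  2 ^ p                                ≡⟨ binomialPrefix≡2^n p (suc p) ≤-refl ⟨
  binomialPrefix p p + p C p           ≡⟨ cong₂ _+_ eq (nCn≡1 p) ⟩
  1 + c * p + 1                        ≡⟨ +-comm (1 + c * p) 1 ⟩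
  2 + c * p                            ∎)
  where open ≡-Reasoning

odd-prime∣Mersenne[p∸1] : ∀ {p} → Prime p → p ≢ 2 → p ∣ Mersenne (p ∸ 1)
odd-prime∣Mersenne[p∸1] {p@(suc n)} pp p≢2 with fermat₂ pp
... | c , 2^p≡2+cp with euclidsLemma 2 (Mersenne n) pp (divides c 2Mn≡cp)
  where
  open ≡-Reasoning
  2Mn≡cp : 2 * Mersenne n ≡ c * p
  2Mn≡cp = +-cancelˡ-≡ 2 _ _ (begin
    2 + 2 * Mersenne n    ≡⟨ cong suc (Mersenne-suc n) ⟨
    1 + Mersenne p        ≡⟨ 2^n≡1+Mersenne p ⟨
    2 ^ p                 ≡⟨ 2^p≡2+cp ⟩
    2 + c * p             ∎)
... | inj₁ p∣2  = contradiction (∣prime⇒≡ prime[2] (prime≢1 pp) p∣2) p≢2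
... | inj₂ p∣Mn = p∣Mn

prime∣Mersenne[prime]⇒≡1+r*x : ∀ {q r} → Prime r → Prime q → q ∣ Mersenne r →
  ∃ λ x → q ≡ 1 + r * x
prime∣Mersenne[prime]⇒≡1+r*x {q@(suc n)} {r} pr pq q∣Mr
  with ∣Mersenne[prime]⇒∣ pr (prime≢1 pq) q∣Mr (odd-prime∣Mersenne[p∸1] pq q≢2)
  where
  q≢2 : q ≢ 2
  q≢2 refl = 2∤Mersenne (<⇒≤ (prime⇒>1 pr)) q∣Mr
... | divides x n≡xr = x , cong suc (trans n≡xr (*-comm x r))

square%4≢3 : ∀ y → (y * y) % 4 ≢ 3
square%4≢3 y eq = residue≢3 (y % 4) (m%n<n y 4) (trans (sym (%-distribˡ-* y y 4)) eq)
  where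
  residue≢3 : ∀ a → a < 4 → (a * a) % 4 ≢ 3
  residue≢3 0 _ ()
  residue≢3 1 _ ()
  residue≢3 2 _ ()
  residue≢3 3 _ ()
  residue≢3 (suc (suc (suc (suc _)))) (s<s (s<s (s<s (s<s ()))))

Mersenne≢square : ∀ {n} → 1 < n → ∀ y → Mersenne n ≢ y * y
Mersenne≢square {suc (suc n)} (s<s z<s) y Mn≡y² = square%4≢3 y (begin
  (y * y) % 4                      ≡⟨ cong (_% 4) Mn≡y² ⟨
  Mersenne (2 + n) % 4             ≡⟨ cong (_% 4) (Mersenne-+ 2 n) ⟩
  (3 + 4 * Mersenne n) % 4         ≡⟨ cong (λ e → (3 + e) % 4) (*-comm 4 (Mersenne n)) ⟩
  (3 + Mersenne n * 4) % 4         ≡⟨ [m+kn]%n≡m%n 3 (Mersenne n) 4 ⟩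
  3                                ∎)
  where open ≡-Reasoning

suc∣^+1⇒suc∣^[2+k]+1 : ∀ p k → suc p ∣ p ^ k + 1 → suc p ∣ p ^ (2 + k) + 1
suc∣^+1⇒suc∣^[2+k]+1 zero     k _ = 1∣ _
suc∣^+1⇒suc∣^[2+k]+1 (suc p′) k p+1∣p^k+1 =
  ∣m+n∣m⇒∣n (subst (2 + p′ ∣_) (sym (identity p′ (suc p′ ^ k))) (∣n⇒∣m*n (suc p′ * suc p′) p+1∣p^k+1))
            (m∣m*n p′)
  where
  -- p² (x + 1) = (p² x + 1) + (p + 1)(p − 1)
  identity : ∀ p′ x → (2 + p′) * p′ + (suc p′ * (suc p′ * x) + 1) ≡ (suc p′ * suc p′) * (x + 1)
  identity = solve-∀

^-square⊎suc∣^+1 : ∀ p k → (∃ λ y → p ^ k ≡ y * y) ⊎ suc p ∣ p ^ k + 1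
^-square⊎suc∣^+1 p zero          = inj₁ (1 , refl)
^-square⊎suc∣^+1 p (suc zero)    = inj₂ (∣-reflexive (trans (+-comm 1 p) (cong (_+ 1) (sym (*-identityʳ p)))))
^-square⊎suc∣^+1 p (suc (suc k)) with ^-square⊎suc∣^+1 p k
... | inj₁ (y , p^k≡y²)  = inj₁ (p * y , trans (cong (λ e → p * (p * e)) p^k≡y²) (square-step p y))
  where
  square-step : ∀ p y → p * (p * (y * y)) ≡ p * y * (p * y)
  square-step = solve-∀
... | inj₂ p+1∣p^k+1 = inj₂ (suc∣^+1⇒suc∣^[2+k]+1 p k p+1∣p^k+1)

onlyPrimeFactor[Mersenne]⇒≡ : ∀ {r p} → 1 < r → Prime p → IsOrder2 p r →
  (∀ q → Prime q → q ∣ Mersenne r → q ≡ p) → Mersenne r ≡ p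
onlyPrimeFactor[Mersenne]⇒≡ {r} {p} 1<r pp ord only
  with onlyPrimeDivisor⇒power {{Mersenne≢0 (<⇒≤ 1<r)}} only
... | k , Mr≡p^k with ^-square⊎suc∣^+1 p k
...   | inj₁ (y , p^k≡y²) = contradiction (trans Mr≡p^k p^k≡y²) (Mersenne≢square 1<r y)
...   | inj₂ p+1∣p^k+1    with ∣2^n⇒≡2^ r (subst (suc p ∣_) p^k+1≡2^r p+1∣p^k+1)
  where
  p^k+1≡2^r : p ^ k + 1 ≡ 2 ^ r
  p^k+1≡2^r = trans (cong (_+ 1) (sym Mr≡p^k)) (trans (+-comm _ 1) (sym (2^n≡1+Mersenne r)))
...     | s , p+1≡2^s = sym (trans p≡Ms (cong Mersenne s≡r))
  where
  p≡Ms : p ≡ Mersenne s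
  p≡Ms = suc-injective (trans p+1≡2^s (2^n≡1+Mersenne s))
  s≡r : s ≡ r
  s≡r = IsOrder2[Mersenne] (Mersenne-cancel-≤ (subst (1 ≤_) p≡Ms (<⇒≤ (prime⇒>1 pp))))
                           (subst (λ e → IsOrder2 e r) p≡Ms ord)

corollary5 : (r : ℕ) → Prime r →
    Prime (Mersenne r) ⇔
      (Σ ℕ λ p → (Prime p × (∃ λ x → p ≡ 1 + r * x) × IsOrder2 p r)
        × (∀ q → Prime q → (∃ λ x → q ≡ 1 + r * x) → IsOrder2 q r → q ≡ p))
corollary5 r pr = mk⇔ to from
  where
  QualifyingPrime : ℕ → Set
  QualifyingPrime q = Prime q × (∃ λ x → q ≡ 1 + r * x) × IsOrder2 q r

  prime∣Mersenne⇒qualifying : ∀ {q} → Prime q → q ∣ Mersenne r → QualifyingPrime q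
  prime∣Mersenne⇒qualifying pq q∣Mr =
    pq , prime∣Mersenne[prime]⇒≡1+r*x pr pq q∣Mr , ∣Mersenne[prime]⇒IsOrder2 pr (prime≢1 pq) q∣Mr

  UniqueQualifyingPrime : Set
  UniqueQualifyingPrime = Σ ℕ λ p → QualifyingPrime p ×
    (∀ q → Prime q → (∃ λ x → q ≡ 1 + r * x) → IsOrder2 q r → q ≡ p)

  to : Prime (Mersenne r) → UniqueQualifyingPrime
  to pM = Mersenne r , prime∣Mersenne⇒qualifying pM ∣-refl ,
          λ q pq _ (_ , q∣Mr , _) → ∣prime⇒≡ pM (prime≢1 pq) q∣Mr

  from : UniqueQualifyingPrime → Prime (Mersenne r)
  from (p , (pp , _ , ord) , unique) = subst Prime (sym Mr≡p) pp
    where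
    Mr≡p : Mersenne r ≡ p
    Mr≡p = onlyPrimeFactor[Mersenne]⇒≡ (prime⇒>1 pr) pp ord
             λ q pq q∣Mr → let (_ , inProgression , order) = prime∣Mersenne⇒qualifying pq q∣Mr
                           in unique q pq inProgression order
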